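{- Let $\mathcal{B}$ be the set of all blocking games. If $G$ is a strictly $\mathscr{P}$-free element of $\mathcal{B}$ that is a Left end with $o(G)=\mathscr{N}$, then $\mathrm{ltp}(G)=1$.
   Context: Games are short misère-play game forms (no tombstones); outcomes $o(G)\in\{\mathscr{L},\mathscr{N},\mathscr{P},\mathscr{R}\}$. $+$ is disjunctive sum; for $n\ge1$ the integer $n$ is $\{n-1\mid\cdot\}$ (with $0=\{\cdot\mid\cdot\}$) and $\overline{n}$ is its conjugate. A subposition of $G$ is any game reachable by a possibly empty, not necessarily alternating, sequence of moves; $G$ is strictly $\mathscr{P}$-free if no subposition has outcome $\mathscr{P}$. $\mathrm{ltp}(G)$ is the least integer $m\ge0$ with $o(G+\overline{m})=\mathscr{L}$. A Left end is a game with no Left options. A Left end $X$ is blocked if for every Right option $X^R$, either $X^R$ is a blocked Left end or some Left option $X^{RL}$ of $X^R$ is a blocked Left end; blocked Right ends symmetrically. A game is blocking if every subposition that is a Left (resp. Right) end is a blocked Left (resp. Right) end. -}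

module Defs where

open import Data.Nat using (ℕ; zero; suc; _<_)
open import Data.Bool using (Bool; true; false; not; _∧_; _∨_)
open import Data.List using (List; []; _∷_; _++_)
open import Data.List.Membership.Propositional using (_∈_)
open import Data.Product using (Σ; ∃; _×_; _,_)
open import Data.Sum using (_⊎_)
open import Relation.Binary.PropositionalEquality using (_≡_; _≢_)

data Game : Set where
  ⟨_∣_⟩ : List Game → List Game → Game

leftOpts : Game → List Game
leftOpts ⟨ ls ∣ _ ⟩ = ls

rightOpts : Game → List Game
rightOpts ⟨ _ ∣ rs ⟩ = rs

-- Misère play: a player with no move on their turn wins.
-- lf G : Left wins G moving first;  rf G : Right wins G moving first.
mutual
  lf : Game → Bool
  lf ⟨ [] ∣ _ ⟩ = true
  lf ⟨ l ∷ ls ∣ _ ⟩ = someNotRf (l ∷ ls)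

  rf : Game → Bool
  rf ⟨ _ ∣ [] ⟩ = true
  rf ⟨ _ ∣ r ∷ rs ⟩ = someNotLf (r ∷ rs)

  someNotRf : List Game → Bool
  someNotRf [] = false
  someNotRf (g ∷ gs) = not (rf g) ∨ someNotRf gs

  someNotLf : List Game → Bool
  someNotLf [] = false
  someNotLf (g ∷ gs) = not (lf g) ∨ someNotLf gs

data Outcome : Set where
  𝓛 𝓝 𝓟 𝓡 : Outcome

outcomeOf : Bool → Bool → Outcome
outcomeOf true  false = 𝓛
outcomeOf true  true  = 𝓝
outcomeOf false false = 𝓟
outcomeOf false true  = 𝓡

o : Game → Outcome
o G = outcomeOf (lf G) (rf G)

mutual
  _+_ : Game → Game → Game
  ⟨ gl ∣ gr ⟩ + ⟨ hl ∣ hr ⟩ =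
    ⟨ addL gl ⟨ hl ∣ hr ⟩ ++ addR ⟨ gl ∣ gr ⟩ hl
    ∣ addL gr ⟨ hl ∣ hr ⟩ ++ addR ⟨ gl ∣ gr ⟩ hr ⟩

  addL : List Game → Game → List Game
  addL [] H = []
  addL (g ∷ gs) H = (g + H) ∷ addL gs H

  addR : Game → List Game → List Game
  addR G [] = []
  addR G (h ∷ hs) = (G + h) ∷ addR G hs

infixl 6 _+_

int : ℕ → Game
int zero = ⟨ [] ∣ [] ⟩
int (suc n) = ⟨ int n ∷ [] ∣ [] ⟩

intbar : ℕ → Game
intbar zero = ⟨ [] ∣ [] ⟩
intbar (suc n) = ⟨ [] ∣ intbar n ∷ [] ⟩

IsLtp : Game → ℕ → Set
IsLtp G m = (o (G + intbar m) ≡ 𝓛) × (∀ k → k < m → o (G + intbar k) ≢ 𝓛)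

data Sub : Game → Game → Set where
  sub-refl : ∀ {G} → Sub G G
  sub-L : ∀ {G H K} → H ∈ leftOpts G → Sub H K → Sub G K
  sub-R : ∀ {G H K} → H ∈ rightOpts G → Sub H K → Sub G K

StrictlyPFree : Game → Set
StrictlyPFree G = ∀ H → Sub G H → o H ≢ 𝓟

IsLeftEnd : Game → Set
IsLeftEnd G = leftOpts G ≡ []

IsRightEnd : Game → Set
IsRightEnd G = rightOpts G ≡ []

data BlockedL : Game → Set where
  blockedL : ∀ {rs} →
    (∀ {x} → x ∈ rs → BlockedL x ⊎ (Σ Game λ y → y ∈ leftOpts x × BlockedL y)) →
    BlockedL ⟨ [] ∣ rs ⟩

data BlockedR : Game → Set where
  blockedR : ∀ {ls} →
    (∀ {x} → x ∈ ls → BlockedR x ⊎ (Σ Game λ y → y ∈ rightOpts x × BlockedR y)) →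
    BlockedR ⟨ ls ∣ [] ⟩

Blocking : Game → Set
Blocking G = ∀ H → Sub G H → (IsLeftEnd H → BlockedL H) × (IsRightEnd H → BlockedR H)

{-# OPTIONS --safe #-}
module Submission where

-- A blocked Left end X satisfies o(X + 1̄) = 𝓛.  Left, moving first, has no move in
-- X + 1̄ and wins.  Right, moving first, either plays to X + 0, a Left end, or to
-- X^R + 1̄, where X^R is itself a blocked Left end (so Left cannot move and wins) or
-- Left answers with X^{RL} + 1̄ for a blocked Left end X^{RL} and wins by induction.
-- Since G + 0 = G has outcome 𝓝, ltp(G) ≠ 0.

open import Defs
open import Data.Nat using (_<_; z≤n; s≤s)
open import Data.Bool using (true; false; not)
open import Data.Bool.Properties using (∨-zeroʳ)
open import Data.List using ([]; _∷_; _++_)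
open import Data.List.Properties using (++-conicalʳ)
open import Data.List.Membership.Propositional using (_∈_)
open import Data.List.Membership.Propositional.Properties using (∈-++⁺ˡ)
open import Data.List.Relation.Unary.Any using (here; there)
open import Data.List.Relation.Unary.All using (All; []; _∷_; tabulate)
open import Data.List.Relation.Unary.All.Properties using (++⁺)
open import Data.Product using (Σ; _×_; _,_; proj₁)
open import Data.Sum using (_⊎_; inj₁; inj₂)
open import Data.Empty using (⊥-elim)
open import Relation.Binary.PropositionalEquality using (_≡_; _≢_; refl; sym; trans; cong₂; subst)

mutual
  +-identityʳ : ∀ G → G + intbar 0 ≡ G
  +-identityʳ ⟨ gl ∣ gr ⟩ = cong₂ ⟨_∣_⟩ (addL-identityʳ gl) (addL-identityʳ gr)

  addL-identityʳ : ∀ gs → addL gs (intbar 0) ++ [] ≡ gs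
  addL-identityʳ []       = refl
  addL-identityʳ (g ∷ gs) = cong₂ _∷_ (+-identityʳ g) (addL-identityʳ gs)

∈-addL : ∀ {g gs} H → g ∈ gs → g + H ∈ addL gs H
∈-addL H (here refl) = here refl
∈-addL H (there g∈gs) = there (∈-addL H g∈gs)

∈-leftOpts-+ : ∀ {g} G H → g ∈ leftOpts G → g + H ∈ leftOpts (G + H)
∈-leftOpts-+ ⟨ _ ∣ _ ⟩ ⟨ _ ∣ _ ⟩ g∈GL = ∈-++⁺ˡ (∈-addL _ g∈GL)

All-addL : ∀ {P : Game → Set} {gs} H → All (λ g → P (g + H)) gs → All P (addL gs H)
All-addL H []         = []
All-addL H (pg ∷ pgs) = pg ∷ All-addL H pgs

someNotLf≡false : ∀ {gs} → All (λ g → lf g ≡ true) gs → someNotLf gs ≡ false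
someNotLf≡false []             = refl
someNotLf≡false (lf-g ∷ lf-gs) rewrite lf-g = someNotLf≡false lf-gs

someNotRf≡true : ∀ {g gs} → g ∈ gs → rf g ≡ false → someNotRf gs ≡ true
someNotRf≡true (here refl) rf-g rewrite rf-g = refl
someNotRf≡true {gs = g′ ∷ _} (there g∈gs) rf-g
  rewrite someNotRf≡true g∈gs rf-g = ∨-zeroʳ (not (rf g′))

rf≡false : ∀ G → rightOpts G ≢ [] → All (λ g → lf g ≡ true) (rightOpts G) → rf G ≡ false
rf≡false ⟨ _ ∣ [] ⟩    GR≢[] _     = ⊥-elim (GR≢[] refl)
rf≡false ⟨ _ ∣ _ ∷ _ ⟩ _     lf-GR = someNotLf≡false lf-GR

lf≡true : ∀ {g} G → g ∈ leftOpts G → rf g ≡ false → lf G ≡ true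
lf≡true ⟨ _ ∷ _ ∣ _ ⟩ g∈GL rf-g = someNotRf≡true g∈GL rf-g

mutual
  blockedL⇒rf[+1̄]≡false : ∀ {X} → BlockedL X → rf (X + intbar 1) ≡ false
  blockedL⇒rf[+1̄]≡false {X@(⟨ [] ∣ rs ⟩)} (blockedL blocked-XR) =
    rf≡false (X + intbar 1) nonempty
      (++⁺ (All-addL (intbar 1) (tabulate (λ r∈rs → lf[+1̄]≡true (blocked-XR r∈rs)))) (refl ∷ []))
    where
    nonempty : addL rs (intbar 1) ++ X + intbar 0 ∷ [] ≢ []
    nonempty e with ++-conicalʳ (addL rs (intbar 1)) _ e
    ... | ()

  lf[+1̄]≡true : ∀ {x} → BlockedL x ⊎ Σ Game (λ y → y ∈ leftOpts x × BlockedL y) →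
    lf (x + intbar 1) ≡ true
  lf[+1̄]≡true (inj₁ (blockedL _)) = refl
  lf[+1̄]≡true {x} (inj₂ (y , y∈xL , blocked-y)) =
    lf≡true (x + intbar 1) (∈-leftOpts-+ x (intbar 1) y∈xL) (blockedL⇒rf[+1̄]≡false blocked-y)

blockedL⇒o[+1̄]≡𝓛 : ∀ {X} → BlockedL X → o (X + intbar 1) ≡ 𝓛
blockedL⇒o[+1̄]≡𝓛 {⟨ [] ∣ _ ⟩} blocked rewrite blockedL⇒rf[+1̄]≡false blocked = refl

proposition4p6 : (G : Game) → Blocking G → StrictlyPFree G → IsLeftEnd G →
    o G ≡ 𝓝 → IsLtp G 1
proposition4p6 G blocking _ G-end oG≡𝓝 =
  blockedL⇒o[+1̄]≡𝓛 (proj₁ (blocking G sub-refl) G-end) , ltp≢0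
  where
  ltp≢0 : ∀ k → k < 1 → o (G + intbar k) ≢ 𝓛
  ltp≢0 _ (s≤s z≤n) o[G+0]≡𝓛
    with trans (sym oG≡𝓝) (subst (λ H → o H ≡ 𝓛) (+-identityʳ G) o[G+0]≡𝓛)
  ... | ()
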